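{- Let $\mathcal{T}=(X,\leq_{\mathcal{T}})$, $\mathcal{S}=(Y,\leq_{\mathcal{S}})$, $\mathcal{U}=(Z,\leq_{\mathcal{U}})$ be three connected finite topological spaces on pairwise disjoint sets, and let $s\in Y$, $u\in Z$. Then $$\mathcal{T}\searrow_s(\mathcal{S}\nearrow^u\mathcal{U})=\Psi_{X,Z}\big((\mathcal{T}\searrow_s\mathcal{S})\nearrow^u\mathcal{U}\big),$$ i.e. $\Psi_{X,Z}\circ\nearrow^u\circ(\searrow_s\otimes\mathrm{id})=\searrow_s\circ(\mathrm{id}\otimes\nearrow^u)$ as maps $\mathbb{V}_X\otimes\mathbb{V}_Y\otimes\mathbb{V}_Z\to\mathbb{V}_{X\sqcup Y\sqcup Z}$.
   Context: A finite topological space is a finite set with a preorder (open sets = upper sets); $\mathbb{V}_X$ is the vector space spanned by connected topologies on $X$. For spaces $\mathcal{A}=(A,\leq_{\mathcal{A}})$, $\mathcal{B}=(B,\leq_{\mathcal{B}})$ on disjoint sets and $v\in B$: $\mathcal{A}\searrow_v\mathcal{B}=(A\sqcup B,\leq)$ with $x\leq y$ iff ($x,y\in A$, $x\leq_{\mathcal{A}}y$) or ($x,y\in B$, $x\leq_{\mathcal{B}}y$) or ($x\in B$, $y\in A$, $x\leq_{\mathcal{B}}v$). Let $j$ be the involution reversing the preorder. Define $\mathcal{A}\nearrow^v\mathcal{B}=j\big(j(\mathcal{A})\searrow_v j(\mathcal{B})\big)$; explicitly $x\leq y$ iff ($x,y\in A$, $x\leq_{\mathcal{A}}y$) or ($x,y\in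 B$, $x\leq_{\mathcal{B}}y$) or ($x\in A$, $y\in B$, $v\leq_{\mathcal{B}}y$). For a topology $\mathcal{W}$ on $W$ and disjoint $W_1,W_2\subset W$, $\Psi_{W_1,W_2}(\mathcal{W})$ is the relation on $W$ in which any $a\in W_1$ and $b\in W_2$ are incomparable (in both orders), and otherwise $a\leq b$ iff $a\leq_{\mathcal{W}}b$. -}

module Defs where

open import Level using (0ℓ)
open import Data.Nat using (ℕ)
open import Data.Fin using (Fin)
open import Data.Bool using (Bool; true; false)
open import Data.Sum using (_⊎_; inj₁; inj₂)
open import Data.Product using (_×_)
open import Data.Empty using (⊥)
open import Data.Unit using (⊤)
open import Relation.Nullary using (¬_)
open import Relation.Binary.Core using (Rel)
open import Relation.Binary.PropositionalEquality using (_≡_)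
open import Relation.Binary.Structures using (IsPreorder)

-- A finite topological space on the finite set Fin n is a preorder on Fin n
-- (open sets = upper sets).
record FinTop (n : ℕ) : Set₁ where
  field
    _≤_        : Rel (Fin n) 0ℓ
    isPreorder : IsPreorder _≡_ _≤_

IsOpen : {A : Set} → Rel A 0ℓ → (A → Bool) → Set
IsOpen R P = ∀ x y → R x y → P x ≡ true → P y ≡ true

IsClosed : {A : Set} → Rel A 0ℓ → (A → Bool) → Set
IsClosed R P = ∀ x y → R x y → P y ≡ true → P x ≡ true

Connected : {n : ℕ} → FinTop n → Set
Connected {n} T =
  (P : Fin n → Bool) → IsOpen (FinTop._≤_ T) P → IsClosed (FinTop._≤_ T) P →
  ((x : Fin n) → P x ≡ true) ⊎ ((x : Fin n) → P x ≡ false)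

j : {A : Set} → Rel A 0ℓ → Rel A 0ℓ
j R x y = R y x

searrow : {A B : Set} → Rel A 0ℓ → Rel B 0ℓ → B → Rel (A ⊎ B) 0ℓ
searrow RA RB v (inj₁ x) (inj₁ y) = RA x y
searrow RA RB v (inj₂ x) (inj₂ y) = RB x y
searrow RA RB v (inj₂ x) (inj₁ y) = RB x v
searrow RA RB v (inj₁ x) (inj₂ y) = ⊥

nearrow : {A B : Set} → Rel A 0ℓ → Rel B 0ℓ → B → Rel (A ⊎ B) 0ℓ
nearrow RA RB v = j (searrow (j RA) (j RB) v)

Psi : {W : Set} → (W → Set) → (W → Set) → Rel W 0ℓ → Rel W 0ℓ
Psi W₁ W₂ R a b = ¬ (W₁ a × W₂ b) × ¬ (W₂ a × W₁ b) × R a b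

inX : {A B C : Set} → (A ⊎ B) ⊎ C → Set
inX (inj₁ (inj₁ _)) = ⊤
inX _ = ⊥

inZ : {A B C : Set} → (A ⊎ B) ⊎ C → Set
inZ (inj₂ _) = ⊤
inZ _ = ⊥

assocʳ : {A B C : Set} → A ⊎ (B ⊎ C) → (A ⊎ B) ⊎ C
assocʳ (inj₁ a) = inj₁ (inj₁ a)
assocʳ (inj₂ (inj₁ b)) = inj₁ (inj₂ b)
assocʳ (inj₂ (inj₂ c)) = inj₂ c

{-# OPTIONS --safe #-}
module Submission where

open import Level using (0ℓ)
open import Defs
open import Data.Nat using (ℕ)
open import Data.Fin using (Fin)
open import Data.Sum using (_⊎_; inj₁; inj₂)
open import Data.Product using (_×_; _,_; proj₂)
open import Data.Unit using (tt)
open import Function using (_∘_)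
open import Function.Bundles using (_⇔_; mk⇔)
open import Relation.Binary.Core using (Rel)
open import Relation.Nullary using (¬_)

-- The identity holds for arbitrary relations, connected or not: away from
-- the pairs X–Z both sides unfold to the same relation, and on X–Z pairs the
-- left side is empty by construction while Ψ_{X,Z} makes the right side empty.

module _ {W : Set} (W₁ W₂ : W → Set) (R : Rel W 0ℓ) (a b : W) where

  Psi-uncrossed : ¬ (W₁ a × W₂ b) → ¬ (W₂ a × W₁ b) → R a b ⇔ Psi W₁ W₂ R a b
  Psi-uncrossed ¬a₁b₂ ¬a₂b₁ = mk⇔ (λ r → ¬a₁b₂ , ¬a₂b₁ , r) (proj₂ ∘ proj₂)

  Psi-empty₁₂ : W₁ a → W₂ b → ¬ Psi W₁ W₂ R a b
  Psi-empty₁₂ a₁ b₂ (¬a₁b₂ , _) = ¬a₁b₂ (a₁ , b₂)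

  Psi-empty₂₁ : W₂ a → W₁ b → ¬ Psi W₁ W₂ R a b
  Psi-empty₂₁ a₂ b₁ (_ , ¬a₂b₁ , _) = ¬a₂b₁ (a₂ , b₁)

module _ {A B C : Set} (R : Rel A 0ℓ) (S : Rel B 0ℓ) (U : Rel C 0ℓ) (s : B) (u : C) where

  private
    Q : Rel ((A ⊎ B) ⊎ C) 0ℓ
    Q = nearrow (searrow R S s) U u

  searrow-nearrow-assoc : (x y : A ⊎ (B ⊎ C)) →
    searrow R (nearrow S U u) (inj₁ s) x y ⇔ Psi inX inZ Q (assocʳ x) (assocʳ y)
  searrow-nearrow-assoc x@(inj₁ _)        y@(inj₁ _)        = Psi-uncrossed inX inZ Q (assocʳ x) (assocʳ y) (λ ()) (λ ())
  searrow-nearrow-assoc (inj₁ _)          (inj₂ (inj₁ _))   = mk⇔ (λ ()) (λ ())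
  searrow-nearrow-assoc x@(inj₁ _)        y@(inj₂ (inj₂ _)) = mk⇔ (λ ()) (Psi-empty₁₂ inX inZ Q (assocʳ x) (assocʳ y) tt tt)
  searrow-nearrow-assoc x@(inj₂ (inj₁ _)) y@(inj₁ _)        = Psi-uncrossed inX inZ Q (assocʳ x) (assocʳ y) (λ ()) (λ ())
  searrow-nearrow-assoc x@(inj₂ (inj₁ _)) y@(inj₂ (inj₁ _)) = Psi-uncrossed inX inZ Q (assocʳ x) (assocʳ y) (λ ()) (λ ())
  searrow-nearrow-assoc x@(inj₂ (inj₁ _)) y@(inj₂ (inj₂ _)) = Psi-uncrossed inX inZ Q (assocʳ x) (assocʳ y) (λ ()) (λ ())
  searrow-nearrow-assoc x@(inj₂ (inj₂ _)) y@(inj₁ _)        = mk⇔ (λ ()) (Psi-empty₂₁ inX inZ Q (assocʳ x) (assocʳ y) tt tt)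
  searrow-nearrow-assoc (inj₂ (inj₂ _))   (inj₂ (inj₁ _))   = mk⇔ (λ ()) (λ ())
  searrow-nearrow-assoc x@(inj₂ (inj₂ _)) y@(inj₂ (inj₂ _)) = Psi-uncrossed inX inZ Q (assocʳ x) (assocʳ y) (λ ()) (λ ())

mainTheorem7 : {n m k : ℕ} (T : FinTop n) (S : FinTop m) (U : FinTop k) →
    Connected T → Connected S → Connected U →
    (s : Fin m) (u : Fin k) →
    (x y : Fin n ⊎ (Fin m ⊎ Fin k)) →
    searrow (FinTop._≤_ T) (nearrow (FinTop._≤_ S) (FinTop._≤_ U) u) (inj₁ s) x y
      ⇔ Psi inX inZ (nearrow (searrow (FinTop._≤_ T) (FinTop._≤_ S) s) (FinTop._≤_ U) u)
          (assocʳ x) (assocʳ y)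
mainTheorem7 T S U _ _ _ =
  searrow-nearrow-assoc (FinTop._≤_ T) (FinTop._≤_ S) (FinTop._≤_ U)
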